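{- Let $G=(A,R,C)$ be an abstract dialectical framework and let $F=(A,R,f_Q)$ be a ⊑-minimal abstraction of $G$, i.e. $F\in\Delta[G]$ and there is no $F'\in\Delta[G]$ with $F'\sqsubset F$. Let $\mathrm{Exact}_{\mathrm{one}}(F)$ be the set of exact labellings $\lambda$ of $F$ such that for every $a\in A$, $\lambda$ designates at most one label for $a$ in $F$. Then $\mathrm{Exact}_{\mathrm{one}}(F)\subseteq\mathrm{Exact}(G)$, where $\mathrm{Exact}(G)$ is the set of exact labellings of $G$.
   Context: Labels: $\mathcal{L}=\{\mathsf{in},\mathsf{out},\mathsf{undec}\}$. For a finite set $S$ of arguments, $\Lambda^S$ is the set of total functions $S\to\mathcal{L}$. A nuance tuple is $((n_1,n_2),(m_1,m_2))\in\mathbb{N}^4$ with $n_1\le n_2$, $m_1\le m_2$. A may-must argumentation (MMA) is $(A,R,f_Q)$ with $A$ finite, $R\subseteq A\times A$, $f_Q$ assigning a nuance tuple to each argument. $\mathrm{pre}(a)=\{b\in A:(b,a)\in R\}$. For $\lambda$ a labelling, $o_\lambda(a)$ (resp. $i_\lambda(a)$) is the number of $b\in\mathrm{pre}(a)$ with $\lambda(b)=\mathsf{out}$ (resp. $\mathsf{in}$). With $f_Q(a)=((n_1,n_2),(m_1,m_2))$: may-a iff $n_1\le o_\lambda(a)$; must-a iff $n_2\le o_\lambda(a)$; may$_s$-a iff $n_1\le o_\lambda(a)<n_2$; not-a iff $o_\lambda(a)<n_1$; may-r, must-r, may$_s$-r, not-r likewise with $m_1,m_2,i_\lambda(a)$.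 $\lambda$ designates $l$ for $a$ in the MMA iff $\lambda$ is defined on all of $\mathrm{pre}(a)$ and: $l=\mathsf{in}$ requires may-a and not must-r; $l=\mathsf{out}$ requires may-r and not must-a; $l=\mathsf{undec}$ requires (must-a and must-r) or may$_s$-a or may$_s$-r or (not-a and not-r). An abstract dialectical framework (ADF) is $(A,R,C)$ with $C=(C_a)_{a\in A}$, $C_a:\Lambda^{\mathrm{pre}(a)}\to\mathcal{L}$; $\lambda$ designates $l$ for $a$ in the ADF iff $\lambda$ is defined on $\mathrm{pre}(a)$ and $C_a(\lambda|_{\mathrm{pre}(a)})=l$. For an MMA or ADF with argument set $A$, $\lambda\in\Lambda^A$ is an exact labelling iff for every $a\in A$, $\lambda$ designates $\lambda(a)$ for $a$. $\Delta[G]$ (abstractions of ADF $G=(A,R,C)$): all MMAs $(A,R,f_Q)$ such that for every $a$, with $f_Q(a)=((n_1,n_2),(m_1,m_2))$, $n_2,m_2\le|\mathrm{pre}(a)|+1$, and for every $\lambda\in\Lambda^{\mathrm{pre}(a)}$, with $o=o_\lambda(a),i=i_\lambda(a)$: $o<n_1,i<m_1\Rightarrow C_a(\lambda)=\mathsf{undec}$; $n_1\le o<n_2,i<m_1\Rightarrow C_a(\lambda)\in\{\mathsf{in},\mathsf{undec}\}$; $n_2\le o,i<m_1\Rightarrow\mathsf{in}$; $o<n_1,m_1\le i<m_2\Rightarrow\{\mathsf{out},\mathsf{undec}\}$; $n_1\le o<n_2,m_1\le i<m_2\Rightarrow$ arbitrary; $n_2\le o,m_1\le i<m_2\Rightarrow\{\mathsf{in},\mathsf{undec}\}$;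 $o<n_1,m_2\le i\Rightarrow\mathsf{out}$; $n_1\le o<n_2,m_2\le i\Rightarrow\{\mathsf{out},\mathsf{undec}\}$; $n_2\le o,m_2\le i\Rightarrow\mathsf{undec}$. Order: $((n_1,n_2),(m_1,m_2))\unlhd((n_1',n_2'),(m_1',m_2'))$ iff $n_1'\le n_1$, $n_2\le n_2'$, $m_1'\le m_1$, $m_2\le m_2'$; $(A,R,f_Q)\sqsubseteq(A,R,f'_Q)$ iff $f_Q(a)\unlhd f'_Q(a)$ for all $a$; $F'\sqsubset F$ iff $F'\sqsubseteq F$ and not $F\sqsubseteq F'$. -}

module Defs where

open import Data.Nat using (ℕ; zero; suc; _≤_; _<_)
open import Data.Bool using (Bool; true; false; T)
open import Data.Unit using (tt)
open import Data.Fin using (Fin)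
open import Data.Product using (Σ; _×_; _,_; proj₁)
open import Data.Sum using (_⊎_)
open import Data.Vec.Functional using (foldr)
open import Data.Nat using (_+_)
open import Relation.Nullary using (¬_)
open import Relation.Binary.PropositionalEquality using (_≡_)

data Label : Set where
  lin lout lundec : Label

_=L_ : Label → Label → Bool
lin =L lin = true
lout =L lout = true
lundec =L lundec = true
_ =L _ = false

-- Arguments: A = Fin n.  Attack relation R ⊆ A × A as a Boolean matrix:
-- R b a = true  iff  (b , a) ∈ R.
Rel : ℕ → Set
Rel n = Fin n → Fin n → Bool

Pre : ∀ {n} → Rel n → Fin n → Set
Pre R a = Σ (Fin _) (λ b → T (R b a))

sumF : ∀ {n} → (Fin n → ℕ) → ℕ
sumF f = foldr _+_ 0 f

cnt : (b : Bool) → (T b → Label) → Label → ℕ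
cnt true f l with f tt =L l
... | true = 1
... | false = 0
cnt false _ _ = 0

countL : ∀ {n} (R : Rel n) (a : Fin n) → (Pre R a → Label) → Label → ℕ
countL R a μ l = sumF (λ b → cnt (R b a) (λ t → μ (b , t)) l)

preSize : ∀ {n} → Rel n → Fin n → ℕ
preSize R a = sumF (λ b → cnt1 (R b a))
  where
  cnt1 : Bool → ℕ
  cnt1 true = 1
  cnt1 false = 0

oP iP : ∀ {n} (R : Rel n) (a : Fin n) → (Pre R a → Label) → ℕ
oP R a μ = countL R a μ lout
iP R a μ = countL R a μ lin

restrict : ∀ {n} (R : Rel n) (a : Fin n) → (Fin n → Label) → Pre R a → Label
restrict R a λ' p = λ' (proj₁ p)

record Nuance : Set where
  constructor nuance
  field
    n1 n2 m1 m2 : ℕ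
    n1≤n2 : n1 ≤ n2
    m1≤m2 : m1 ≤ m2
open Nuance public

Cond : ∀ {n} → Rel n → Set
Cond {n} R = (a : Fin n) → (Pre R a → Label) → Label

-- MMA (A,R,f_Q): f_Q : A → Nuance (A and R are shared with the ADF)
NuanceFun : ℕ → Set
NuanceFun n = Fin n → Nuance

module _ {n : ℕ} (R : Rel n) (f : NuanceFun n) (λ' : Fin n → Label) (a : Fin n) where
  private
    o = oP R a (restrict R a λ')
    i = iP R a (restrict R a λ')
    q = f a
  mayA mustA maySA notA mayR mustR maySR notR : Set
  mayA = n1 q ≤ o
  mustA = n2 q ≤ o
  maySA = n1 q ≤ o × o < n2 q
  notA = o < n1 q
  mayR = m1 q ≤ i
  mustR = m2 q ≤ i
  maySR = m1 q ≤ i × i < m2 q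
  notR = i < m1 q

MMADesignates : ∀ {n} (R : Rel n) (f : NuanceFun n) (λ' : Fin n → Label) (a : Fin n) → Label → Set
MMADesignates R f λ' a lin = mayA R f λ' a × ¬ mustR R f λ' a
MMADesignates R f λ' a lout = mayR R f λ' a × ¬ mustA R f λ' a
MMADesignates R f λ' a lundec =
  (mustA R f λ' a × mustR R f λ' a) ⊎ maySA R f λ' a ⊎ maySR R f λ' a ⊎ (notA R f λ' a × notR R f λ' a)

ADFDesignates : ∀ {n} (R : Rel n) (C : Cond R) (λ' : Fin n → Label) (a : Fin n) → Label → Set
ADFDesignates R C λ' a l = C a (restrict R a λ') ≡ l

ExactMMA : ∀ {n} (R : Rel n) (f : NuanceFun n) → (Fin n → Label) → Set
ExactMMA R f λ' = ∀ a → MMADesignates R f λ' a (λ' a)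

ExactADF : ∀ {n} (R : Rel n) (C : Cond R) → (Fin n → Label) → Set
ExactADF R C λ' = ∀ a → ADFDesignates R C λ' a (λ' a)

ExactOne : ∀ {n} (R : Rel n) (f : NuanceFun n) → (Fin n → Label) → Set
ExactOne R f λ' = ExactMMA R f λ' ×
  (∀ a l l' → MMADesignates R f λ' a l → MMADesignates R f λ' a l' → l ≡ l')

IsAbstraction : ∀ {n} (R : Rel n) (C : Cond R) (f : NuanceFun n) → Set
IsAbstraction {n} R C f = ∀ (a : Fin n) →
  (n2 (f a) ≤ suc (preSize R a)) × (m2 (f a) ≤ suc (preSize R a)) ×
  (∀ (μ : Pre R a → Label) → let o = oP R a μ ; i = iP R a μ ; q = f a ; c = C a μ in
     (o < n1 q → i < m1 q → c ≡ lundec) ×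
     (n1 q ≤ o → o < n2 q → i < m1 q → (c ≡ lin ⊎ c ≡ lundec)) ×
     (n2 q ≤ o → i < m1 q → c ≡ lin) ×
     (o < n1 q → m1 q ≤ i → i < m2 q → (c ≡ lout ⊎ c ≡ lundec)) ×
     (n2 q ≤ o → m1 q ≤ i → i < m2 q → (c ≡ lin ⊎ c ≡ lundec)) ×
     (o < n1 q → m2 q ≤ i → c ≡ lout) ×
     (n1 q ≤ o → o < n2 q → m2 q ≤ i → (c ≡ lout ⊎ c ≡ lundec)) ×
     (n2 q ≤ o → m2 q ≤ i → c ≡ lundec))
  -- (the case n1 ≤ o < n2, m1 ≤ i < m2 imposes no constraint)

_⊴_ : Nuance → Nuance → Set
q ⊴ q' = (n1 q' ≤ n1 q) × (n2 q ≤ n2 q') × (m1 q' ≤ m1 q) × (m2 q ≤ m2 q')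

_⊑_ : ∀ {n} → NuanceFun n → NuanceFun n → Set
f ⊑ f' = ∀ a → f a ⊴ f' a

_⊏_ : ∀ {n} → NuanceFun n → NuanceFun n → Set
f' ⊏ f = f' ⊑ f × ¬ (f ⊑ f')

IsMinimalAbstraction : ∀ {n} (R : Rel n) (C : Cond R) (f : NuanceFun n) → Set
IsMinimalAbstraction R C f =
  IsAbstraction R C f × (∀ f' → IsAbstraction R C f' → ¬ (f' ⊏ f))

module Submission where

-- A label
-- designated alone for a pins the counts o, i into a "corner" region of the
-- nuance tuple: in forces n2 ≤ o and i < m1, out forces o < n1 and m2 ≤ i, and
-- undec forces both counts above or both below their bounds.  The middle
-- regions n1 ≤ o < n2 and m1 ≤ i < m2 are excluded because there undec is
-- designated together with in or out.  On each corner region the abstraction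
-- conditions fix C a to exactly that label.

open import Defs
open import Data.Nat using (ℕ; _≤_; _<_)
open import Data.Nat.Properties using (≤-trans; _≤?_; ≰⇒>; <⇒≱)
open import Data.Fin using (Fin)
open import Data.Product using (_×_; _,_)
open import Data.Sum using (_⊎_; inj₁; inj₂)
open import Relation.Nullary using (¬_; yes; no; contradiction)
open import Relation.Binary.PropositionalEquality using (_≡_)

module _ {n : ℕ} (R : Rel n) (f : NuanceFun n) (λ' : Fin n → Label) (a : Fin n) where

  private
    D : Label → Set
    D = MMADesignates R f λ' a

    o i : ℕ
    o = oP R a (restrict R a λ')
    i = iP R a (restrict R a λ')

  Unambiguous : Set
  Unambiguous = ∀ l l' → D l → D l' → l ≡ l'

  maySA⇒in⊎out : maySA R f λ' a → D lin ⊎ D lout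
  maySA⇒in⊎out (n1≤o , o<n2) with m2 (f a) ≤? i
  ... | no ¬mustR = inj₁ (n1≤o , ¬mustR)
  ... | yes mustR = inj₂ (≤-trans (m1≤m2 (f a)) mustR , <⇒≱ o<n2)

  maySR⇒in⊎out : maySR R f λ' a → D lin ⊎ D lout
  maySR⇒in⊎out (m1≤i , i<m2) with n2 (f a) ≤? o
  ... | no ¬mustA = inj₂ (m1≤i , ¬mustA)
  ... | yes mustA = inj₁ (≤-trans (n1≤n2 (f a)) mustA , <⇒≱ i<m2)

  module _ (unambiguous : Unambiguous) where

    private
      in-excludes-undec : D lin → ¬ D lundec
      in-excludes-undec d-in d-undec with unambiguous lin lundec d-in d-undec
      ... | ()

      out-excludes-undec : D lout → ¬ D lundec
      out-excludes-undec d-out d-undec with unambiguous lout lundec d-out d-undec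
      ... | ()

      in⊎out-excludes-undec : D lin ⊎ D lout → ¬ D lundec
      in⊎out-excludes-undec (inj₁ d-in) = in-excludes-undec d-in
      in⊎out-excludes-undec (inj₂ d-out) = out-excludes-undec d-out

    unambiguous-in : D lin → mustA R f λ' a × notR R f λ' a
    unambiguous-in d@(mayA , ¬mustR) with n2 (f a) ≤? o | m1 (f a) ≤? i
    ... | no ¬mustA | _ =
      contradiction (inj₂ (inj₁ (mayA , ≰⇒> ¬mustA))) (in-excludes-undec d)
    ... | yes _ | yes mayR =
      contradiction (inj₂ (inj₂ (inj₁ (mayR , ≰⇒> ¬mustR)))) (in-excludes-undec d)
    ... | yes mustA | no ¬mayR = mustA , ≰⇒> ¬mayR

    unambiguous-out : D lout → notA R f λ' a × mustR R f λ' a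
    unambiguous-out d@(mayR , ¬mustA) with n1 (f a) ≤? o | m2 (f a) ≤? i
    ... | _ | no ¬mustR =
      contradiction (inj₂ (inj₂ (inj₁ (mayR , ≰⇒> ¬mustR)))) (out-excludes-undec d)
    ... | yes mayA | yes _ =
      contradiction (inj₂ (inj₁ (mayA , ≰⇒> ¬mustA))) (out-excludes-undec d)
    ... | no ¬mayA | yes mustR = ≰⇒> ¬mayA , mustR

    unambiguous-undec : D lundec →
      (mustA R f λ' a × mustR R f λ' a) ⊎ (notA R f λ' a × notR R f λ' a)
    unambiguous-undec (inj₁ both-must) = inj₁ both-must
    unambiguous-undec d@(inj₂ (inj₁ maySA)) =
      contradiction d (in⊎out-excludes-undec (maySA⇒in⊎out maySA))
    unambiguous-undec d@(inj₂ (inj₂ (inj₁ maySR))) =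
      contradiction d (in⊎out-excludes-undec (maySR⇒in⊎out maySR))
    unambiguous-undec (inj₂ (inj₂ (inj₂ both-not))) = inj₂ both-not

module _ {n : ℕ} {R : Rel n} {C : Cond R} {f : NuanceFun n}
         (abstraction : IsAbstraction R C f) where

  module _ (a : Fin n) (μ : Pre R a → Label) where

    private
      q : Nuance
      q = f a

      o i : ℕ
      o = oP R a μ
      i = iP R a μ

    abstraction-in : n2 q ≤ o → i < m1 q → C a μ ≡ lin
    abstraction-in with abstraction a
    ... | _ , _ , regions with regions μ
    ... | _ , _ , in-region , _ = in-region

    abstraction-out : o < n1 q → m2 q ≤ i → C a μ ≡ lout
    abstraction-out with abstraction a
    ... | _ , _ , regions with regions μ
    ... | _ , _ , _ , _ , _ , out-region , _ = out-region

    abstraction-undec-must : n2 q ≤ o → m2 q ≤ i → C a μ ≡ lundec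
    abstraction-undec-must with abstraction a
    ... | _ , _ , regions with regions μ
    ... | _ , _ , _ , _ , _ , _ , _ , undec-region = undec-region

    abstraction-undec-not : o < n1 q → i < m1 q → C a μ ≡ lundec
    abstraction-undec-not with abstraction a
    ... | _ , _ , regions with regions μ
    ... | undec-region , _ = undec-region

  abstraction-agrees : ∀ λ' a → Unambiguous R f λ' a →
    ∀ l → MMADesignates R f λ' a l → ADFDesignates R C λ' a l
  abstraction-agrees λ' a unambiguous lin d
    with unambiguous-in R f λ' a unambiguous d
  ... | mustA , notR = abstraction-in a (restrict R a λ') mustA notR
  abstraction-agrees λ' a unambiguous lout d
    with unambiguous-out R f λ' a unambiguous d
  ... | notA , mustR = abstraction-out a (restrict R a λ') notA mustR
  abstraction-agrees λ' a unambiguous lundec d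
    with unambiguous-undec R f λ' a unambiguous d
  ... | inj₁ (mustA , mustR) = abstraction-undec-must a (restrict R a λ') mustA mustR
  ... | inj₂ (notA , notR) = abstraction-undec-not a (restrict R a λ') notA notR

mainTheorem7 : (n : ℕ) (R : Rel n) (C : Cond R) (f : NuanceFun n) →
    IsMinimalAbstraction R C f →
    (λ' : Fin n → Label) → ExactOne R f λ' → ExactADF R C λ'
mainTheorem7 n R C f (abstraction , _) λ' (exact , unambiguous) a =
  abstraction-agrees abstraction λ' a (unambiguous a) (λ' a) (exact a)
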